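{- Let $\mathbb{F}_q$ be a finite field, let $n\ge 2$ be a divisor of $q-1$, let $\gamma\in\mathbb{F}_q^*$ have order $n$, and let $G=\langle\gamma\rangle$. Let $N$ be an integer, let $H\le n$ and $s\ge 0$ be integers, and let $S\subseteq\{N+1,\ldots,N+H\}$ have cardinality $|S|=H-s$. Let $f:G\to G$ be any mapping satisfying $f(\gamma^x)=\gamma^{x^2}$ for all $x\in S$. Then $$ind(f)\ge \frac{n}{2(n-H+2s+1)}.$$
   Context: For a positive divisor $\ell$ of $n$, let $C_{\ell,0}=\{\gamma^{j\ell}: j=0,1,\ldots,n/\ell-1\}$ and $C_{\ell,i}=\gamma^i C_{\ell,0}$ for $i=0,1,\ldots,\ell-1$. For a self-mapping $f$ of $G$, $ind(f)$ denotes the smallest positive divisor $\ell$ of $n$ such that there exist a positive integer $r$ and $a_0,\ldots,a_{\ell-1}\in G$ with $f(x)=a_i x^r$ whenever $x\in C_{\ell,i}$, $i=0,\ldots,\ell-1$. -}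

module Defs where

open import Level using (_⊔_)
open import Algebra.Bundles using (CommutativeRing)
import Algebra.Bundles
open import Data.Nat using (ℕ; zero; suc; _<_; _≤_; NonZero)
open import Data.Nat.Divisibility using (_∣_; quotient)
open import Data.Integer using (ℤ; _%ℕ_) renaming (_*_ to _*ℤ_)
open import Data.Fin using (Fin; toℕ)
open import Data.Product using (Σ; ∃; _×_; _,_; proj₁)
open import Relation.Nullary using (¬_)
open import Relation.Binary.PropositionalEquality using (_≡_)
import Algebra.Definitions.RawSemiring as RS

record IsFiniteField {c ℓ} (R : CommutativeRing c ℓ) (q : ℕ) : Set (c ⊔ ℓ) where
  open CommutativeRing R
  field
    0≉1       : ¬ (0# ≈ 1#)
    inverse   : ∀ x → ¬ (x ≈ 0#) → ∃ λ y → x * y ≈ 1#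
    enum      : Fin q → Carrier
    enum-surj : ∀ x → ∃ λ i → enum i ≈ x
    enum-inj  : ∀ i j → enum i ≈ enum j → i ≡ j

module Cyclic {c ℓ} (R : CommutativeRing c ℓ) (γ : CommutativeRing.Carrier R) where
  open CommutativeRing R
  open RS (Algebra.Bundles.Semiring.rawSemiring semiring) public using (_^_)

  HasOrder : ℕ → Set ℓ
  HasOrder n = (γ ^ n ≈ 1#) × (∀ k → 0 < k → k < n → ¬ (γ ^ k ≈ 1#))

  G : Set (c ⊔ ℓ)
  G = Σ Carrier λ x → ∃ λ k → x ≈ γ ^ k

  val : G → Carrier
  val = proj₁

  pw : ℕ → G
  pw k = γ ^ k , k , refl

  pwℤ : (n : ℕ) .{{_ : NonZero n}} → ℤ → G
  pwℤ n x = pw (x %ℕ n)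

  Congruent : (G → G) → Set (c ⊔ ℓ)
  Congruent f = ∀ x y → val x ≈ val y → val (f x) ≈ val (f y)

  -- x ∈ C_{ℓ,i} = γ^i {γ^{jℓ} : j = 0,…,n/ℓ-1}, where m = n/ℓ
  InC : (l m i : ℕ) → G → Set ℓ
  InC l m i x = ∃ λ j → j < m × (val x ≈ γ ^ i * γ ^ (j Data.Nat.* l))

  Admissible : (n : ℕ) → (G → G) → ℕ → Set (c ⊔ ℓ)
  Admissible n f l =
    0 < l × Σ (l ∣ n) λ d →
      ∃ λ (r : ℕ) → 0 < r × ∃ λ (a : Fin l → G) →
        ∀ (i : Fin l) (x : G) → InC l (quotient d) (toℕ i) x →
          val (f x) ≈ val (a i) * val x ^ r

  IsInd : (n : ℕ) → (G → G) → ℕ → Set (c ⊔ ℓ)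
  IsInd n f l = Admissible n f l × (∀ l′ → Admissible n f l′ → l ≤ l′)

{-# OPTIONS --safe #-}
module Submission where

-- If f(x) = aᵢ xʳ on the cosets of the subgroup of index l, then x and x + l lie in the same coset,
-- and comparing f(γˣ) = γ^(x²) with f(γ^(x+l)) = γ^((x+l)²) gives (x+l)² + xr ≡ x² + (x+l)r (mod n).
-- Subtracting this congruence at x from the one at x + 1 leaves n ∣ 2l. Such a quadruple
-- x, x + l, x + 1, x + 1 + l inside S exists unless the s points of the interval missing from S block
-- all H − l − 1 candidates for x; each missing point blocks at most four of them, so then
-- H − l − 1 ≤ 4s.

open import Defs
open import Algebra.Bundles using (CommutativeRing)
open import Data.Bool using (Bool; true; false; not; _∨_; if_then_else_)
open import Data.Empty using (⊥-elim)
open import Data.Fin using (Fin; toℕ; fromℕ<)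
open import Data.Fin.Properties using (toℕ-fromℕ<; fromℕ<-cong)
open import Data.Integer using (ℤ; +_; ∣_∣; _%ℕ_; _/ℕ_)
  renaming (_+_ to _+ℤ_; _*_ to _*ℤ_; _-_ to _-ℤ_; -_ to -ℤ_; _≤_ to _≤ℤ_)
import Data.Integer.Properties as ℤ
open import Data.Integer.DivMod using (a≡a%ℕn+[a/ℕn]*n; n%ℕd<d)
open import Data.Integer.Divisibility.Signed using (divides; ∣ᵤ⇒∣; ∣⇒∣ᵤ; ∣-trans; ∣m∣n⇒∣m+n; ∣m∣n⇒∣m-n; ∣m⇒∣-m; ∣m⇒∣m*n)
  renaming (_∣_ to _∣ℤ_)
open import Data.Integer.Tactic.RingSolver using (solve-∀)
open import Data.List using (List; []; _∷_; length)
open import Data.List.Membership.Propositional using (_∈_)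
open import Data.List.Relation.Unary.All as All using (All; []; _∷_)
open import Data.List.Relation.Unary.Any using (here)
open import Data.List.Relation.Unary.All.Properties using (All¬⇒¬Any)
open import Data.List.Relation.Unary.Unique.Propositional using (Unique; []; _∷_)
open import Data.Nat using (ℕ; zero; suc; _≤_; _<_; _+_; _*_; _∸_; _%_; _/_; NonZero; >-nonZero; z≤n; s≤s; z<s; s≤s⁻¹; s<s⁻¹; _≤?_)
open import Data.Nat.Properties
  using ( ≤-refl; ≤-reflexive; ≤-trans; ≤-antisym; ≤-total; ≤-<-trans; <⇒≤; <⇒≢; ≤∧≢⇒<; ≰⇒>; _≟_
        ; n≤1+n; m<n⇒m<1+n; m≤n⇒m<n∨m≡n; suc-injective
        ; +-comm; +-suc; +-identityʳ; +-mono-≤; +-monoˡ-≤; +-monoʳ-≤; +-cancelˡ-≤; m≤m+n; m≤m*n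
        ; m+[n∸m]≡n; m≤n+m∸n; m∸n≤m; m∸n≡0⇒m≤n; m∸n≢0⇒n<m
        ; module ≤-Reasoning )
open import Data.Nat.DivMod using (m≡m%n+[m/n]*n; %-remove-+ʳ; m<n⇒m%n≡m; m<n*o⇒m/o<n)
open import Data.Nat.Divisibility using (_∣_; ∣⇒≤; quotient)
import Data.Nat.Tactic.RingSolver as ℕ-Ring
open import Data.Product using (∃; _×_; _,_; proj₁; proj₂)
open import Data.Sum using (_⊎_; inj₁; inj₂; [_,_]′)
open import Function using (_∘_)
open import Relation.Nullary using (¬_; yes; no; does)
open import Relation.Nullary.Decidable using (dec-true; dec-false)
open import Relation.Binary.Definitions using (DecidableEquality)
open import Relation.Binary.PropositionalEquality using (_≡_; _≢_; refl; sym; trans; cong; subst; subst₂; module ≡-Reasoning)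

infix 4 _≡_mod_

-- A record rather than a bare divisibility, so that x and y can be inferred.
record _≡_mod_ (x y : ℤ) (m : ℕ) : Set where
  constructor congruent
  field modulus∣difference : + m ∣ℤ x -ℤ y
open _≡_mod_

≡-mod-sym : ∀ {m x y} → x ≡ y mod m → y ≡ x mod m
≡-mod-sym {x = x} {y} (congruent m∣x-y) = congruent (subst (_ ∣ℤ_) (negated x y) (∣m⇒∣-m m∣x-y))
  where
  negated : ∀ x y → -ℤ (x -ℤ y) ≡ y -ℤ x
  negated = solve-∀

≡-mod-trans : ∀ {m x y z} → x ≡ y mod m → y ≡ z mod m → x ≡ z mod m
≡-mod-trans {x = x} {y} {z} (congruent p) (congruent q) = congruent (subst (_ ∣ℤ_) (telescope x y z) (∣m∣n⇒∣m+n p q))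
  where
  telescope : ∀ x y z → (x -ℤ y) +ℤ (y -ℤ z) ≡ x -ℤ z
  telescope = solve-∀

≡-mod-+ : ∀ {m x x′ y y′} → x ≡ x′ mod m → y ≡ y′ mod m → x +ℤ y ≡ x′ +ℤ y′ mod m
≡-mod-+ {x = x} {x′} {y} {y′} (congruent p) (congruent q) =
  congruent (subst (_ ∣ℤ_) (regroup x x′ y y′) (∣m∣n⇒∣m+n p q))
  where
  regroup : ∀ x x′ y y′ → (x -ℤ x′) +ℤ (y -ℤ y′) ≡ (x +ℤ y) -ℤ (x′ +ℤ y′)
  regroup = solve-∀

≡-mod-*ʳ : ∀ {m x y} k → x ≡ y mod m → x *ℤ k ≡ y *ℤ k mod m
≡-mod-*ʳ {x = x} {y} k (congruent p) = congruent (subst (_ ∣ℤ_) (distrib x y k) (∣m⇒∣m*n k p))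
  where
  distrib : ∀ x y k → (x -ℤ y) *ℤ k ≡ x *ℤ k -ℤ y *ℤ k
  distrib = solve-∀

≡-mod-+-modulus : ∀ {m x} → x +ℤ + m ≡ x mod m
≡-mod-+-modulus {m} {x} = congruent (divides (+ 1) (cancel x (+ m)))
  where
  cancel : ∀ x k → (x +ℤ k) -ℤ x ≡ + 1 *ℤ k
  cancel = solve-∀

≡-mod-∣ : ∀ {m d x y} → d ∣ m → x ≡ y mod m → x ≡ y mod d
≡-mod-∣ d∣m (congruent p) = congruent (∣-trans (∣ᵤ⇒∣ d∣m) p)

module _ {m : ℕ} .{{_ : NonZero m}} where

  ≡-mod-%ℕ : ∀ x → x ≡ + (x %ℕ m) mod m
  ≡-mod-%ℕ x = congruent (divides (x /ℕ m) (begin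
    x -ℤ + (x %ℕ m)                              ≡⟨ cong (_-ℤ + (x %ℕ m)) (a≡a%ℕn+[a/ℕn]*n x m) ⟩
    (+ (x %ℕ m) +ℤ (x /ℕ m) *ℤ + m) -ℤ + (x %ℕ m) ≡⟨ cancel (+ (x %ℕ m)) ((x /ℕ m) *ℤ + m) ⟩
    (x /ℕ m) *ℤ + m                              ∎))
    where
    open ≡-Reasoning
    cancel : ∀ r k → (r +ℤ k) -ℤ r ≡ k
    cancel = solve-∀

  %ℕ≡⇒≡-mod : ∀ {x y} → x %ℕ m ≡ y %ℕ m → x ≡ y mod m
  %ℕ≡⇒≡-mod {x} {y} eq = ≡-mod-trans (≡-mod-%ℕ x)
    (subst (λ r → + r ≡ y mod m) (sym eq) (≡-mod-sym (≡-mod-%ℕ y)))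

  private
    ≤-≡-mod⇒%≡ : ∀ {a b} → a ≤ b → + a ≡ + b mod m → a % m ≡ b % m
    ≤-≡-mod⇒%≡ {a} {b} a≤b (congruent m∣a-b) = begin
      a % m             ≡⟨ %-remove-+ʳ a m∣b∸a ⟨
      (a + (b ∸ a)) % m ≡⟨ cong (_% m) (m+[n∸m]≡n a≤b) ⟩
      b % m             ∎
      where
      open ≡-Reasoning
      m∣b∸a : m ∣ b ∸ a
      m∣b∸a = subst (m ∣_) (trans (cong ∣_∣ (ℤ.m-n≡m⊖n a b)) (ℤ.∣⊖∣-≤ a≤b)) (∣⇒∣ᵤ m∣a-b)

  ≡-mod⇒%≡ : ∀ {a b} → + a ≡ + b mod m → a % m ≡ b % m
  ≡-mod⇒%≡ {a} {b} a≡b with ≤-total a b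
  ... | inj₁ a≤b = ≤-≡-mod⇒%≡ a≤b a≡b
  ... | inj₂ b≤a = sym (≤-≡-mod⇒%≡ b≤a (≡-mod-sym a≡b))

  ≡-mod⇒%ℕ≡ : ∀ {x y} → x ≡ y mod m → x %ℕ m ≡ y %ℕ m
  ≡-mod⇒%ℕ≡ {x} {y} x≡y = begin
    x %ℕ m     ≡⟨ m<n⇒m%n≡m (n%ℕd<d x m) ⟨
    x %ℕ m % m ≡⟨ ≡-mod⇒%≡ (≡-mod-trans (≡-mod-sym (≡-mod-%ℕ x)) (≡-mod-trans x≡y (≡-mod-%ℕ y))) ⟩
    y %ℕ m % m ≡⟨ m<n⇒m%n≡m (n%ℕd<d y m) ⟩
    y %ℕ m     ∎
    where open ≡-Reasoning


module PowersOfOrder {c ℓ} (R : CommutativeRing c ℓ) (γ : CommutativeRing.Carrier R)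
                     (n : ℕ) .{{_ : NonZero n}} (order : Cyclic.HasOrder R γ n) where

  open CommutativeRing R
    using (Carrier; _≈_; 1#; *-cong; *-congˡ; *-congʳ; *-assoc; *-identityˡ; *-identityʳ; setoid; semiring)
    renaming (_*_ to _·_; sym to ≈-sym; trans to ≈-trans; reflexive to ≈-reflexive)
  open Cyclic R γ using (G; val; pwℤ; InC)
  open import Algebra.Properties.Semiring.Exp semiring using (_^_; ^-homo-*; ^-assocʳ)
  open import Algebra.Properties.CommutativeSemigroup (CommutativeRing.*-commutativeSemigroup R) using (xy∙z≈xz∙y)
  open import Relation.Binary.Reasoning.Setoid setoid

  ^-multiple-of-order : ∀ k → γ ^ (k * n) ≈ 1#
  ^-multiple-of-order zero    = CommutativeRing.refl R
  ^-multiple-of-order (suc k) = begin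
    γ ^ (n + k * n)     ≈⟨ ^-homo-* γ n (k * n) ⟩
    γ ^ n · γ ^ (k * n) ≈⟨ *-cong (proj₁ order) (^-multiple-of-order k) ⟩
    1# · 1#             ≈⟨ *-identityˡ 1# ⟩
    1#                  ∎

  ^-% : ∀ a → γ ^ a ≈ γ ^ (a % n)
  ^-% a = begin
    γ ^ a                         ≡⟨ cong (γ ^_) (m≡m%n+[m/n]*n a n) ⟩
    γ ^ (a % n + a / n * n)       ≈⟨ ^-homo-* γ (a % n) (a / n * n) ⟩
    γ ^ (a % n) · γ ^ (a / n * n) ≈⟨ *-congˡ (^-multiple-of-order (a / n)) ⟩
    γ ^ (a % n) · 1#              ≈⟨ *-identityʳ _ ⟩
    γ ^ (a % n)                   ∎

  ^-cancel : ∀ {a d} → a ≤ n → γ ^ (a + d) ≈ γ ^ a → γ ^ d ≈ 1#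
  ^-cancel {a} {d} a≤n γᵃ⁺ᵈ≈γᵃ = begin
    γ ^ d                         ≈⟨ *-identityʳ _ ⟨
    γ ^ d · 1#                    ≈⟨ *-congˡ γᵃγⁿ⁻ᵃ≈1 ⟨
    γ ^ d · (γ ^ a · γ ^ (n ∸ a)) ≈⟨ *-assoc _ _ _ ⟨
    (γ ^ d · γ ^ a) · γ ^ (n ∸ a) ≈⟨ *-congʳ (^-homo-* γ d a) ⟨
    γ ^ (d + a) · γ ^ (n ∸ a)     ≡⟨ cong (λ e → γ ^ e · γ ^ (n ∸ a)) (+-comm d a) ⟩
    γ ^ (a + d) · γ ^ (n ∸ a)     ≈⟨ *-congʳ γᵃ⁺ᵈ≈γᵃ ⟩
    γ ^ a · γ ^ (n ∸ a)           ≈⟨ γᵃγⁿ⁻ᵃ≈1 ⟩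
    1#                            ∎
    where
    γᵃγⁿ⁻ᵃ≈1 : γ ^ a · γ ^ (n ∸ a) ≈ 1#
    γᵃγⁿ⁻ᵃ≈1 = ≈-trans (≈-sym (^-homo-* γ a (n ∸ a)))
                       (≈-trans (≈-reflexive (cong (γ ^_) (m+[n∸m]≡n a≤n))) (proj₁ order))

  private
    ≤-^-injective : ∀ {a b} → a ≤ b → b < n → γ ^ a ≈ γ ^ b → a ≡ b
    ≤-^-injective {a} {b} a≤b b<n γᵃ≈γᵇ with b ∸ a in b∸a≡
    ... | zero  = ≤-antisym a≤b (m∸n≡0⇒m≤n b∸a≡)
    ... | suc d = ⊥-elim (proj₂ order (suc d) z<s 1+d<n (^-cancel (≤-trans a≤b (<⇒≤ b<n)) γᵃ⁺ᵈ≈γᵃ))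
      where
      1+d<n : suc d < n
      1+d<n = subst (_< n) b∸a≡ (≤-<-trans (m∸n≤m b a) b<n)
      γᵃ⁺ᵈ≈γᵃ : γ ^ (a + suc d) ≈ γ ^ a
      γᵃ⁺ᵈ≈γᵃ = ≈-trans (≈-reflexive (cong (γ ^_) (trans (cong (λ e → a + e) (sym b∸a≡)) (m+[n∸m]≡n a≤b))))
                        (≈-sym γᵃ≈γᵇ)

  ^-injective : ∀ {a b} → a < n → b < n → γ ^ a ≈ γ ^ b → a ≡ b
  ^-injective {a} {b} a<n b<n γᵃ≈γᵇ with ≤-total a b
  ... | inj₁ a≤b = ≤-^-injective a≤b b<n γᵃ≈γᵇ
  ... | inj₂ b≤a = sym (≤-^-injective b≤a a<n (≈-sym γᵃ≈γᵇ))

  γ^ℤ : ℤ → Carrier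
  γ^ℤ x = val (pwℤ n x)

  γ^ℤ-≡-mod : ∀ {x a} → x ≡ + a mod n → γ^ℤ x ≈ γ ^ a
  γ^ℤ-≡-mod {x} {a} x≡a = ≈-trans (≈-reflexive (cong (γ ^_) (≡-mod⇒%ℕ≡ x≡a))) (≈-sym (^-% a))

  γ^ℤ-+ : ∀ x y → γ^ℤ (x +ℤ y) ≈ γ^ℤ x · γ^ℤ y
  γ^ℤ-+ x y = ≈-trans (γ^ℤ-≡-mod x+y≡) (^-homo-* γ (x %ℕ n) (y %ℕ n))
    where
    x+y≡ : x +ℤ y ≡ + (x %ℕ n + y %ℕ n) mod n
    x+y≡ = subst (λ z → x +ℤ y ≡ z mod n) (sym (ℤ.pos-+ (x %ℕ n) (y %ℕ n))) (≡-mod-+ (≡-mod-%ℕ x) (≡-mod-%ℕ y))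

  γ^ℤ-*-+ : ∀ x r → γ^ℤ (x *ℤ + r) ≈ γ^ℤ x ^ r
  γ^ℤ-*-+ x r = ≈-trans (γ^ℤ-≡-mod xr≡) (≈-sym (^-assocʳ γ (x %ℕ n) r))
    where
    xr≡ : x *ℤ + r ≡ + (x %ℕ n * r) mod n
    xr≡ = subst (λ z → x *ℤ + r ≡ z mod n) (sym (ℤ.pos-* (x %ℕ n) r)) (≡-mod-*ʳ (+ r) (≡-mod-%ℕ x))

  γ^ℤ-injective : ∀ {x y} → γ^ℤ x ≈ γ^ℤ y → x ≡ y mod n
  γ^ℤ-injective {x} {y} γˣ≈γʸ = %ℕ≡⇒≡-mod (^-injective (n%ℕd<d x n) (n%ℕd<d y n) γˣ≈γʸ)

  module IndexMap (f : G → G) (l : ℕ) .{{_ : NonZero l}} (l∣n : l ∣ n) (r : ℕ) (a : Fin l → G)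
    (f-coset : ∀ (i : Fin l) (x : G) → InC l (quotient l∣n) (toℕ i) x → val (f x) ≈ val (a i) · val x ^ r)
    where

    residue : ℤ → Fin l
    residue x = fromℕ< (n%ℕd<d x l)

    residue-+l : ∀ x → residue (x +ℤ + l) ≡ residue x
    residue-+l x = fromℕ<-cong _ _ (≡-mod⇒%ℕ≡ (≡-mod-+-modulus {l} {x})) _ _

    f-γ^ℤ : ∀ x → val (f (pwℤ n x)) ≈ val (a (residue x)) · γ^ℤ x ^ r
    f-γ^ℤ x = f-coset (residue x) (pwℤ n x) (e / l , e/l<n/l , γᵉ-split)
      where
      e = x %ℕ n
      e/l<n/l : e / l < quotient l∣n
      e/l<n/l = m<n*o⇒m/o<n (subst (e <_) (_∣_.equality l∣n) (n%ℕd<d x n))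
      residue≡e%l : toℕ (residue x) ≡ e % l
      residue≡e%l = trans (toℕ-fromℕ< _) (≡-mod⇒%ℕ≡ (≡-mod-∣ l∣n (≡-mod-%ℕ x)))
      γᵉ-split : γ ^ e ≈ γ ^ toℕ (residue x) · γ ^ (e / l * l)
      γᵉ-split = begin
        γ ^ e                                 ≡⟨ cong (γ ^_) (m≡m%n+[m/n]*n e l) ⟩
        γ ^ (e % l + e / l * l)               ≈⟨ ^-homo-* γ (e % l) (e / l * l) ⟩
        γ ^ (e % l) · γ ^ (e / l * l)         ≡⟨ cong (λ i → γ ^ i · γ ^ (e / l * l)) residue≡e%l ⟨
        γ ^ toℕ (residue x) · γ ^ (e / l * l) ∎

    Squares : ℤ → Set ℓ
    Squares x = val (f (pwℤ n x)) ≈ γ^ℤ (x *ℤ x)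

    squares-l-apart : ∀ x → Squares x → Squares (x +ℤ + l) →
                      (x +ℤ + l) *ℤ (x +ℤ + l) +ℤ x *ℤ + r ≡ x *ℤ x +ℤ (x +ℤ + l) *ℤ + r mod n
    squares-l-apart x fx fy = γ^ℤ-injective (begin
      γ^ℤ (y *ℤ y +ℤ x *ℤ + r)              ≈⟨ γ^ℤ-+ (y *ℤ y) (x *ℤ + r) ⟩
      γ^ℤ (y *ℤ y) · γ^ℤ (x *ℤ + r)          ≈⟨ *-cong (≈-trans (≈-sym fy) (f-γ^ℤ y)) (γ^ℤ-*-+ x r) ⟩
      (val (a (residue y)) · γ^ℤ y ^ r) · γ^ℤ x ^ r ≡⟨ cong (λ i → (val (a i) · γ^ℤ y ^ r) · γ^ℤ x ^ r) (residue-+l x) ⟩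
      (aₓ · γ^ℤ y ^ r) · γ^ℤ x ^ r          ≈⟨ xy∙z≈xz∙y aₓ _ _ ⟩
      (aₓ · γ^ℤ x ^ r) · γ^ℤ y ^ r          ≈⟨ *-cong (≈-trans (≈-sym (f-γ^ℤ x)) fx) (≈-sym (γ^ℤ-*-+ y r)) ⟩
      γ^ℤ (x *ℤ x) · γ^ℤ (y *ℤ + r)          ≈⟨ γ^ℤ-+ (x *ℤ x) (y *ℤ + r) ⟨
      γ^ℤ (x *ℤ x +ℤ y *ℤ + r)              ∎)
      where
      y = x +ℤ + l
      aₓ = val (a (residue x))

    quadruple⇒n∣2l : ∀ x → Squares x → Squares (x +ℤ + l) → Squares (x +ℤ + 1) → Squares (x +ℤ + 1 +ℤ + l) →
                     n ∣ 2 * l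
    quadruple⇒n∣2l x f₀ fₗ f₁ f₁₊ₗ =
      subst (n ∣_) (ℤ.abs-* (+ 2) (+ l))
        (∣⇒∣ᵤ (subst (_ ∣ℤ_) (second-difference x (+ l) (+ r))
          (∣m∣n⇒∣m-n (modulus∣difference (squares-l-apart (x +ℤ + 1) f₁ f₁₊ₗ))
                     (modulus∣difference (squares-l-apart x f₀ fₗ)))))
      where
      second-difference : ∀ x l r →
        ((x +ℤ + 1 +ℤ l) *ℤ (x +ℤ + 1 +ℤ l) +ℤ (x +ℤ + 1) *ℤ r -ℤ ((x +ℤ + 1) *ℤ (x +ℤ + 1) +ℤ (x +ℤ + 1 +ℤ l) *ℤ r))
          -ℤ ((x +ℤ l) *ℤ (x +ℤ l) +ℤ x *ℤ r -ℤ (x *ℤ x +ℤ (x +ℤ l) *ℤ r))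
        ≡ + 2 *ℤ l
      second-difference = solve-∀

count : (ℕ → Bool) → ℕ → ℕ
count p zero    = zero
count p (suc k) = if p k then suc (count p k) else count p k

count-≤-suc : ∀ p k → count p k ≤ count p (suc k)
count-≤-suc p k with p k
... | true  = n≤1+n _
... | false = ≤-refl

count-mono : ∀ p {j k} → j ≤ k → count p j ≤ count p k
count-mono p {k = zero}  z≤n   = ≤-refl
count-mono p {k = suc k} j≤1+k with m≤n⇒m<n∨m≡n j≤1+k
... | inj₁ j<1+k = ≤-trans (count-mono p (s≤s⁻¹ j<1+k)) (count-≤-suc p k)
... | inj₂ refl  = ≤-refl

count-shift : ∀ p c k → count (λ i → p (c + i)) k ≤ count p (c + k)
count-shift p c zero    = z≤n
count-shift p c (suc k) rewrite +-suc c k with p (c + k)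
... | true  = s≤s (count-shift p c k)
... | false = count-shift p c k

count-∨ : ∀ p q k → count (λ i → p i ∨ q i) k ≤ count p k + count q k
count-∨ p q zero = z≤n
count-∨ p q (suc k) with p k | q k
... | true  | true  = s≤s (≤-trans (count-∨ p q k) (+-monoʳ-≤ (count p k) (n≤1+n _)))
... | true  | false = s≤s (count-∨ p q k)
... | false | true  = ≤-trans (s≤s (count-∨ p q k)) (≤-reflexive (sym (+-suc _ _)))
... | false | false = count-∨ p q k

count-complement : ∀ p k → count p k + count (not ∘ p) k ≡ k
count-complement p zero = refl
count-complement p (suc k) with p k
... | true  = cong suc (count-complement p k)
... | false = trans (+-suc _ _) (cong suc (count-complement p k))

count<-witness : ∀ p k → count p k < k → ∃ λ i → i < k × p i ≡ false
count<-witness p (suc k) #p<1+k with p k in pₖ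
... | false = k , ≤-refl , pₖ
... | true with count<-witness p k (s<s⁻¹ #p<1+k)
...   | i , i<k , pᵢ = i , m<n⇒m<1+n i<k , pᵢ

count-ext : ∀ {p q} k → (∀ j → j < k → p j ≡ q j) → count p k ≡ count q k
count-ext zero    p≗q = refl
count-ext {p} {q} (suc k) p≗q rewrite p≗q k ≤-refl with q k
... | true  = cong suc (count-ext k (λ j j<k → p≗q j (m<n⇒m<1+n j<k)))
... | false = count-ext k (λ j j<k → p≗q j (m<n⇒m<1+n j<k))

count-insert : ∀ {p q i} k → i < k → p i ≡ true → q i ≡ false → (∀ j → j ≢ i → p j ≡ q j) →
               count p k ≡ suc (count q k)
count-insert {p} {q} {i} (suc k) i<1+k pᵢ qᵢ p≗q with i ≟ k
... | yes refl rewrite pᵢ | qᵢ = cong suc (count-ext k (λ j j<k → p≗q j (<⇒≢ j<k)))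
... | no i≢k rewrite p≗q k (i≢k ∘ sym)
  with q k | count-insert k (≤∧≢⇒< (s≤s⁻¹ i<1+k) i≢k) pᵢ qᵢ p≗q
...   | true  | #p≡1+#q = cong suc #p≡1+#q
...   | false | #p≡1+#q = #p≡1+#q

module _ {a} {A : Set a} (_≟ᴬ_ : DecidableEquality A) where
  open import Data.List.Membership.DecPropositional _≟ᴬ_ using (_∈?_)

  length-≤-count : (e : ℕ → A) → (∀ {i j} → e i ≡ e j → i ≡ j) → ∀ k (xs : List A) → Unique xs →
                   All (λ y → ∃ λ i → i < k × y ≡ e i) xs → length xs ≤ count (λ j → does (e j ∈? xs)) k
  length-≤-count e e-injective k []       _                   _ = z≤n
  length-≤-count e e-injective k (y ∷ ys) (y∉ys ∷ ys-unique) ((i , i<k , y≡eᵢ) ∷ ys-range) =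
    subst (suc (length ys) ≤_) (sym one-more) (s≤s (length-≤-count e e-injective k ys ys-unique ys-range))
    where
    eᵢ∉ys : ¬ e i ∈ ys
    eᵢ∉ys = All¬⇒¬Any (subst (λ z → All (z ≢_) ys) y≡eᵢ y∉ys)
    elsewhere : ∀ j → j ≢ i → does (e j ∈? (y ∷ ys)) ≡ does (e j ∈? ys)
    elsewhere j j≢i with e j ≟ᴬ y
    ... | yes eⱼ≡y = ⊥-elim (j≢i (e-injective (trans eⱼ≡y y≡eᵢ)))
    ... | no _     = refl
    one-more : count (λ j → does (e j ∈? (y ∷ ys))) k ≡ suc (count (λ j → does (e j ∈? ys)) k)
    one-more = count-insert k i<k (dec-true (e i ∈? (y ∷ ys)) (here (sym y≡eᵢ))) (dec-false (e i ∈? ys) eᵢ∉ys) elsewhere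

module Interval (N : ℤ) where
  open import Data.List.Membership.DecPropositional ℤ._≟_ using (_∈?_)

  point : ℕ → ℤ
  point j = N +ℤ + suc j

  private
    cancel : ∀ N z → -ℤ N +ℤ (N +ℤ z) ≡ z
    cancel = solve-∀

  point-injective : ∀ {i j} → point i ≡ point j → i ≡ j
  point-injective {i} {j} eq =
    suc-injective (ℤ.+-injective (trans (sym (cancel N _)) (trans (cong (-ℤ N +ℤ_) eq) (cancel N _))))

  point-+ : ∀ c j → point (c + j) ≡ point j +ℤ + c
  point-+ c j = trans (cong (λ t → N +ℤ + suc t) (+-comm c j)) (sym (ℤ.+-assoc N (+ suc j) (+ c)))

  InInterval : ℕ → ℤ → Set
  InInterval H y = (N +ℤ + 1 ≤ℤ y) × (y ≤ℤ N +ℤ + H)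

  point-onto : ∀ {H y} → InInterval H y → ∃ λ i → i < H × y ≡ point i
  point-onto {H} {y} (N<y , y≤N+H) = i , i<H , y≡pointᵢ
    where
    open ≡-Reasoning
    d = y -ℤ (N +ℤ + 1)
    i = ∣ d ∣
    regroup : ∀ y N → y ≡ N +ℤ (+ 1 +ℤ (y -ℤ (N +ℤ + 1)))
    regroup = solve-∀
    y≡pointᵢ : y ≡ point i
    y≡pointᵢ = begin
      y                  ≡⟨ regroup y N ⟩
      N +ℤ (+ 1 +ℤ d)    ≡⟨ cong (λ t → N +ℤ (+ 1 +ℤ t)) (ℤ.0≤i⇒+∣i∣≡i (ℤ.i≤j⇒0≤j-i N<y)) ⟨
      N +ℤ (+ 1 +ℤ + i)  ∎
    i<H : i < H
    i<H = ℤ.drop‿+≤+ (subst₂ _≤ℤ_ (cancel N _) (cancel N _)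
            (ℤ.+-monoʳ-≤ (-ℤ N) (subst (_≤ℤ N +ℤ + H) y≡pointᵢ y≤N+H)))

  missing : List ℤ → ℕ → Bool
  missing S j = not (does (point j ∈? S))

  #missing≤ : ∀ {H s S} → Unique S → All (InInterval H) S → length S + s ≡ H → count (missing S) H ≤ s
  #missing≤ {H} {s} {S} S-unique S-range |S|+s≡H = +-cancelˡ-≤ (count present H) (count (missing S) H) s (begin
    count present H + count (missing S) H ≡⟨ count-complement present H ⟩
    H                                     ≡⟨ |S|+s≡H ⟨
    length S + s                          ≤⟨ +-monoˡ-≤ s (length-≤-count ℤ._≟_ point point-injective H S S-unique
                                                           (All.map point-onto S-range)) ⟩
    count present H + s                   ∎)
    where
    open ≤-Reasoning
    present : ℕ → Bool
    present j = does (point j ∈? S)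

HasQuadruple : ℕ → List ℤ → Set
HasQuadruple l S = ∃ λ x → x ∈ S × x +ℤ + l ∈ S × x +ℤ + 1 ∈ S × x +ℤ + 1 +ℤ + l ∈ S

quadruple-or-sparse : ∀ N H s l (S : List ℤ) → Unique S → All (Interval.InInterval N H) S →
                      length S + s ≡ H → HasQuadruple l S ⊎ H ∸ suc l ≤ 4 * s
quadruple-or-sparse N H s l S S-unique S-range |S|+s≡H with H ∸ suc l ≤? 4 * s
... | yes sparse = inj₂ sparse
... | no ¬sparse = inj₁ quadruple
  where
  open Interval N
  open import Data.List.Membership.DecPropositional ℤ._≟_ using (_∈?_)

  k = H ∸ suc l

  blocked : ℕ → Bool
  blocked i = missing S i ∨ missing S (l + i) ∨ missing S (1 + i) ∨ missing S (suc l + i)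

  1+l+k≡H : suc l + k ≡ H
  1+l+k≡H = m+[n∸m]≡n {suc l} {H} (<⇒≤ (m∸n≢0⇒n<m λ k≡0 → ¬sparse (subst (_≤ 4 * s) (sym k≡0) z≤n)))

  #shifted-missing≤s : ∀ c → c ≤ suc l → count (λ i → missing S (c + i)) k ≤ s
  #shifted-missing≤s c c≤1+l = ≤-trans (count-shift (missing S) c k)
    (≤-trans (count-mono (missing S) (≤-trans (+-monoˡ-≤ k c≤1+l) (≤-reflexive 1+l+k≡H)))
             (#missing≤ S-unique S-range |S|+s≡H))

  #blocked≤4s : count blocked k ≤ 4 * s
  #blocked≤4s =
    ≤-trans (count-∨ _ _ k) (+-mono-≤ (#shifted-missing≤s 0 z≤n)
    (≤-trans (count-∨ _ _ k) (+-mono-≤ (#shifted-missing≤s l (n≤1+n l))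
    (≤-trans (count-∨ _ _ k) (+-mono-≤ (#shifted-missing≤s 1 (s≤s z≤n))
    (≤-trans (#shifted-missing≤s (suc l) ≤-refl) (≤-reflexive (sym (+-identityʳ s)))))))))

  unblocked⇒quadruple : ∀ i → blocked i ≡ false → HasQuadruple l S
  unblocked⇒quadruple i unblocked
    with point i ∈? S | point (l + i) ∈? S | point (1 + i) ∈? S | point (suc l + i) ∈? S
  ... | yes p₀ | yes pₗ | yes p₁ | yes p₁₊ₗ =
    point i , p₀ , subst (_∈ S) (point-+ l i) pₗ , subst (_∈ S) (point-+ 1 i) p₁ ,
    subst (_∈ S) (trans (point-+ (suc l) i) (sym (ℤ.+-assoc (point i) (+ 1) (+ l)))) p₁₊ₗ
  unblocked⇒quadruple i () | no _  | _     | _     | _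
  unblocked⇒quadruple i () | yes _ | no _  | _     | _
  unblocked⇒quadruple i () | yes _ | yes _ | no _  | _
  unblocked⇒quadruple i () | yes _ | yes _ | yes _ | no _

  quadruple : HasQuadruple l S
  quadruple with count<-witness blocked k (≤-<-trans #blocked≤4s (≰⇒> ¬sparse))
  ... | i , _ , unblocked = unblocked⇒quadruple i unblocked

n∣2l⇒bound : ∀ {n l} m → 0 < l → n ∣ 2 * l → n ≤ 2 * l * (m + 1)
n∣2l⇒bound {n} {suc e} m _ n∣2l =
  subst (λ t → n ≤ 2 * suc e * t) (+-comm 1 m) (≤-trans (∣⇒≤ n∣2l) (m≤m*n (2 * suc e) (suc m)))

sparse⇒bound : ∀ {n H s l} → H ∸ suc l ≤ 4 * s → 0 < l → H ≤ n → n ≤ 2 * l * (n ∸ H + 2 * s + 1)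
sparse⇒bound {n} {H} {s} {suc e} sparse _ H≤n = begin
  n                                                     ≡⟨ m+[n∸m]≡n H≤n ⟨
  H + m                                                 ≤⟨ +-monoˡ-≤ m H≤2+e+4s ⟩
  2 + e + 4 * s + m                                     ≤⟨ m≤m+n _ (e + m + 2 * e * m + 4 * e * s) ⟩
  2 + e + 4 * s + m + (e + m + 2 * e * m + 4 * e * s)   ≡⟨ expand e m s ⟩
  2 * suc e * (m + 2 * s + 1)                           ∎
  where
  open ≤-Reasoning
  m = n ∸ H
  H≤2+e+4s : H ≤ 2 + e + 4 * s
  H≤2+e+4s = ≤-trans (m≤n+m∸n H (2 + e)) (+-monoʳ-≤ (2 + e) sparse)
  expand : ∀ e m s → 2 + e + 4 * s + m + (e + m + 2 * e * m + 4 * e * s) ≡ 2 * suc e * (m + 2 * s + 1)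
  expand = ℕ-Ring.solve-∀

theorem5 : ∀ {c ℓ} (R : CommutativeRing c ℓ) (q : ℕ) → IsFiniteField R q →
    (n : ℕ) .{{_ : NonZero n}} → 2 ≤ n → n ∣ q ∸ 1 →
    (γ : CommutativeRing.Carrier R) → Cyclic.HasOrder R γ n →
    (N : ℤ) (H s : ℕ) → H ≤ n →
    (S : List ℤ) → Unique S →
    All (λ x → (N +ℤ + 1 ≤ℤ x) × (x ≤ℤ N +ℤ + H)) S →
    length S + s ≡ H →
    (f : Cyclic.G R γ → Cyclic.G R γ) → Cyclic.Congruent R γ f →
    (∀ x → x ∈ S →
      CommutativeRing._≈_ R (Cyclic.val R γ (f (Cyclic.pwℤ R γ n x)))
                            (Cyclic.val R γ (Cyclic.pwℤ R γ n (x *ℤ x)))) →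
    ∀ l → Cyclic.IsInd R γ n f l →
    n ≤ 2 * l * (n ∸ H + 2 * s + 1)
theorem5 R q _ n _ _ γ order N H s H≤n S S-unique S-range |S|+s≡H f _ f-squares l
         ((0<l , l∣n , r , _ , a , f-coset) , _) =
  [ (λ (x , x∈S , x+l∈S , x+1∈S , x+1+l∈S) → n∣2l⇒bound (n ∸ H + 2 * s) 0<l
        (quadruple⇒n∣2l x (f-squares _ x∈S) (f-squares _ x+l∈S) (f-squares _ x+1∈S) (f-squares _ x+1+l∈S)))
  , (λ sparse → sparse⇒bound {s = s} sparse 0<l H≤n)
  ]′ (quadruple-or-sparse N H s l S S-unique S-range |S|+s≡H)
  where
  open PowersOfOrder R γ n order
  open IndexMap f l {{>-nonZero 0<l}} l∣n r a f-coset
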